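{- If $G$ is a connected simple graph that is $(2K_2,\text{claw})$-free and satisfies $\alpha(G) \geq 3$, then $G$ is split.
   Context: $2K_2$ is the graph consisting of two vertex-disjoint edges; a claw is $K_{1,3}$. A graph is $(H_1,H_2)$-free if it has no induced subgraph isomorphic to $H_1$ or $H_2$. $\alpha(G)$ is the maximum size of an independent set of $G$. A graph is split if its vertex set can be partitioned into a clique and an independent set. -}

module Defs where

open import Data.Nat using (ℕ)
open import Data.Fin using (Fin; zero; suc)
open import Data.Bool using (Bool; true; false; T)
open import Data.Bool.Properties using (T?)
open import Data.Empty using (⊥)
open import Data.Unit using (⊤)
open import Data.Product using (Σ; ∃; _×_; _,_)
open import Relation.Nullary using (¬_; Dec)
open import Relation.Binary.PropositionalEquality using (_≡_)
open import Relation.Binary.Construct.Closure.ReflexiveTransitive using (Star)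
open import Function.Bundles using (_⇔_)
open import Function.Definitions using (Injective)

record Graph (n : ℕ) : Set₁ where
  field
    Adj     : Fin n → Fin n → Set
    adj?    : ∀ u v → Dec (Adj u v)
    sym     : ∀ {u v} → Adj u v → Adj v u
    irrefl  : ∀ {u} → ¬ Adj u u
open Graph public

HasInduced : ∀ {k n} → Graph k → Graph n → Set
HasInduced {k} H G =
  Σ (Fin k → Fin _) λ f →
    Injective _≡_ _≡_ f × (∀ i j → (Adj G (f i) (f j) ⇔ Adj H i j))

Free : ∀ {k n} → Graph k → Graph n → Set
Free H G = ¬ HasInduced H G

2K2-adj : Fin 4 → Fin 4 → Bool
2K2-adj zero (suc zero) = true
2K2-adj (suc zero) zero = true
2K2-adj (suc (suc zero)) (suc (suc (suc zero))) = true
2K2-adj (suc (suc (suc zero))) (suc (suc zero)) = true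
2K2-adj _ _ = false

claw-adj : Fin 4 → Fin 4 → Bool
claw-adj zero (suc _) = true
claw-adj (suc _) zero = true
claw-adj _ _ = false

2K2-sym : ∀ {u v} → T (2K2-adj u v) → T (2K2-adj v u)
2K2-sym {zero} {suc zero} t = t
2K2-sym {suc zero} {zero} t = t
2K2-sym {suc (suc zero)} {suc (suc (suc zero))} t = t
2K2-sym {suc (suc (suc zero))} {suc (suc zero)} t = t
2K2-sym {zero} {zero} ()
2K2-sym {zero} {suc (suc _)} ()
2K2-sym {suc zero} {suc _} ()
2K2-sym {suc (suc zero)} {zero} ()
2K2-sym {suc (suc zero)} {suc zero} ()
2K2-sym {suc (suc zero)} {suc (suc zero)} ()
2K2-sym {suc (suc (suc zero))} {zero} ()
2K2-sym {suc (suc (suc zero))} {suc zero} ()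
2K2-sym {suc (suc (suc zero))} {suc (suc (suc zero))} ()

2K2-irr : ∀ {u} → ¬ T (2K2-adj u u)
2K2-irr {zero} ()
2K2-irr {suc zero} ()
2K2-irr {suc (suc zero)} ()
2K2-irr {suc (suc (suc zero))} ()

2K2 : Graph 4
2K2 = record { Adj = λ u v → T (2K2-adj u v) ; adj? = λ u v → T? (2K2-adj u v)
             ; sym = λ {u} {v} → 2K2-sym {u} {v} ; irrefl = λ {u} → 2K2-irr {u} }

claw-sym : ∀ {u v} → T (claw-adj u v) → T (claw-adj v u)
claw-sym {zero} {suc _} t = t
claw-sym {suc _} {zero} t = t
claw-sym {zero} {zero} ()
claw-sym {suc _} {suc _} ()

claw-irr : ∀ {u} → ¬ T (claw-adj u u)
claw-irr {zero} ()
claw-irr {suc _} ()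

claw : Graph 4
claw = record { Adj = λ u v → T (claw-adj u v) ; adj? = λ u v → T? (claw-adj u v)
              ; sym = λ {u} {v} → claw-sym {u} {v} ; irrefl = λ {u} → claw-irr {u} }

Connected : ∀ {n} → Graph n → Set
Connected G = ∀ u v → Star (Adj G) u v

α≥3 : ∀ {n} → Graph n → Set
α≥3 G = Σ _ λ a → Σ _ λ b → Σ _ λ c →
  (¬ a ≡ b) × (¬ a ≡ c) × (¬ b ≡ c) ×
  (¬ Adj G a b) × (¬ Adj G a c) × (¬ Adj G b c)

IsSplit : ∀ {n} → Graph n → Set
IsSplit G = Σ (Fin _ → Bool) λ inK →
  (∀ u v → inK u ≡ true → inK v ≡ true → ¬ u ≡ v → Adj G u v) ×
  (∀ u v → inK u ≡ false → inK v ≡ false → ¬ Adj G u v)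

-- By the Földes–Hammer characterisation, a 2K₂-free graph with no induced C₄ or C₅ is
-- split: its non-simplicial vertices, together with the simplicial vertices that have a
-- simplicial neighbour, form a clique, and the remaining vertices are independent.
-- In a connected (2K₂, claw)-free graph an induced C₄ or C₅ is adjacent to every vertex,
-- and then every vertex other than two cycle vertices p, q at distance two is adjacent to
-- p or to q. But two non-adjacent vertices cannot dominate an independent triple: one of
-- them would be the centre of a claw, or they would span a 2K₂ with two vertices of the
-- triple. As some such pair {p, q} is disjoint from the triple, α ≥ 3 excludes both cycles.
module Submission where

open import Defs
open import Data.Nat using (ℕ; s≤s)
open import Data.Fin using (Fin; zero; suc; _<_)
open import Data.Fin.Properties using (_≟_; <-cmp; any?; all?; ¬∀⟶∃¬)
open import Data.Bool using (true; false)
open import Data.Empty using (⊥; ⊥-elim)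
open import Data.Unit using (tt)
open import Data.Sum using (_⊎_; inj₁; inj₂)
open import Data.Product using (∃; ∃₂; _×_; _,_; proj₁; proj₂)
open import Function using (_∘_; const; case_of_)
open import Function.Bundles using (_⇔_; mk⇔; Equivalence)
open import Function.Definitions using (Injective)
open import Relation.Binary using (tri<; tri≈; tri>)
open import Relation.Binary.PropositionalEquality using (_≡_; _≢_; refl; ≢-sym)
open import Relation.Binary.Construct.Closure.ReflexiveTransitive using (Star; ε; _◅_)
open import Relation.Nullary using (¬_; Dec; yes; no; does; ¬?)
open import Relation.Nullary.Decidable using (_×-dec_; _⊎-dec_; map′; decidable-stable)

symmetric-on-<⇒≢ : ∀ {k} {S : Fin k → Fin k → Set} → (∀ {i j} → S i j → S j i) →
                   (∀ {i j} → i < j → S i j) → ∀ {i j} → i ≢ j → S i j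
symmetric-on-<⇒≢ S-sym S< {i} {j} i≢j with <-cmp i j
... | tri< i<j _ _ = S< i<j
... | tri≈ _ i≡j _ = ⊥-elim (i≢j i≡j)
... | tri> _ _ j<i = S-sym (S< j<i)

does≡true⇒ : ∀ {P : Set} (P? : Dec P) → does P? ≡ true → P
does≡true⇒ (yes p) _ = p

does≡false⇒¬ : ∀ {P : Set} (P? : Dec P) → does P? ≡ false → ¬ P
does≡false⇒¬ (no ¬p) _ = ¬p

module _ {n : ℕ} (G : Graph n) where

  infix 4 _~_ _≁_ _~?_

  _~_ : Fin n → Fin n → Set
  _~_ = Adj G

  _≁_ : Fin n → Fin n → Set
  u ≁ v = ¬ u ~ v

  _~?_ : ∀ u v → Dec (u ~ v)
  _~?_ = adj? G

  ~-sym : ∀ {u v} → u ~ v → v ~ u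
  ~-sym = sym G

  ≁-sym : ∀ {u v} → u ≁ v → v ≁ u
  ≁-sym u≁v = u≁v ∘ ~-sym

  ~⇒≢ : ∀ {u v} → u ~ v → u ≢ v
  ~⇒≢ u~v refl = irrefl G u~v

  separated⇒≢ : ∀ {w u v} → w ~ u → w ≁ v → u ≢ v
  separated⇒≢ w~u w≁v refl = w≁v w~u

  pairwise⇒induced : ∀ {k} (H : Graph k) (f : Fin k → Fin n) →
                     (∀ {i j} → i < j → f i ≢ f j × (f i ~ f j ⇔ Adj H i j)) → HasInduced H G
  pairwise⇒induced H f pair = f , injective , adjacency
    where
    injective : Injective _≡_ _≡_ f
    injective {i} {j} fi≡fj with i ≟ j
    ... | yes i≡j = i≡j
    ... | no i≢j = ⊥-elim (symmetric-on-<⇒≢ {S = λ i j → f i ≢ f j} ≢-sym (proj₁ ∘ pair) i≢j fi≡fj)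

    flip : ∀ {i j} → f i ~ f j ⇔ Adj H i j → f j ~ f i ⇔ Adj H j i
    flip e = mk⇔ (sym H ∘ to ∘ ~-sym) (~-sym ∘ from ∘ sym H)
      where open Equivalence e

    adjacency : ∀ i j → f i ~ f j ⇔ Adj H i j
    adjacency i j with i ≟ j
    ... | yes refl = mk⇔ (⊥-elim ∘ irrefl G) (⊥-elim ∘ irrefl H)
    ... | no i≢j = symmetric-on-<⇒≢ {S = λ i j → f i ~ f j ⇔ Adj H i j} flip (proj₂ ∘ pair) i≢j

  edge : ∀ {u v} {P : Set} → P → u ~ v → u ≢ v × (u ~ v ⇔ P)
  edge p u~v = ~⇒≢ u~v , mk⇔ (const p) (const u~v)

  non-edge : ∀ {u v} {P : Set} → ¬ P → u ≢ v → u ≁ v → u ≢ v × (u ~ v ⇔ P)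
  non-edge ¬p u≢v u≁v = u≢v , mk⇔ (⊥-elim ∘ u≁v) (⊥-elim ∘ ¬p)

  induced-2K2 : ∀ {w x y z} → w ~ x → y ~ z → w ≁ y → w ≁ z → x ≁ y → x ≁ z → HasInduced 2K2 G
  induced-2K2 {w} {x} {y} {z} w~x y~z w≁y w≁z x≁y x≁z = pairwise⇒induced 2K2 vertex pair
    where
    vertex : Fin 4 → Fin n
    vertex zero = w
    vertex (suc zero) = x
    vertex (suc (suc zero)) = y
    vertex (suc (suc (suc zero))) = z

    pair : ∀ {i j} → i < j → vertex i ≢ vertex j × (vertex i ~ vertex j ⇔ Adj 2K2 i j)
    pair {zero} {suc zero} _ = edge tt w~x
    pair {zero} {suc (suc zero)} _ = non-edge (λ ()) (separated⇒≢ (~-sym w~x) x≁y) w≁y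
    pair {zero} {suc (suc (suc zero))} _ = non-edge (λ ()) (separated⇒≢ (~-sym w~x) x≁z) w≁z
    pair {suc zero} {suc (suc zero)} _ = non-edge (λ ()) (separated⇒≢ w~x w≁y) x≁y
    pair {suc zero} {suc (suc (suc zero))} _ = non-edge (λ ()) (separated⇒≢ w~x w≁z) x≁z
    pair {suc (suc zero)} {suc (suc (suc zero))} _ = edge tt y~z
    pair {_} {zero} ()
    pair {suc zero} {suc zero} (s≤s ())
    pair {suc (suc zero)} {suc zero} (s≤s ())
    pair {suc (suc zero)} {suc (suc zero)} (s≤s (s≤s ()))
    pair {suc (suc (suc zero))} {suc zero} (s≤s ())
    pair {suc (suc (suc zero))} {suc (suc zero)} (s≤s (s≤s ()))
    pair {suc (suc (suc zero))} {suc (suc (suc zero))} (s≤s (s≤s (s≤s ())))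

  induced-claw : ∀ {c x y z} → c ~ x → c ~ y → c ~ z → x ≁ y → x ≁ z → y ≁ z →
                 x ≢ y → x ≢ z → y ≢ z → HasInduced claw G
  induced-claw {c} {x} {y} {z} c~x c~y c~z x≁y x≁z y≁z x≢y x≢z y≢z = pairwise⇒induced claw vertex pair
    where
    vertex : Fin 4 → Fin n
    vertex zero = c
    vertex (suc zero) = x
    vertex (suc (suc zero)) = y
    vertex (suc (suc (suc zero))) = z

    pair : ∀ {i j} → i < j → vertex i ≢ vertex j × (vertex i ~ vertex j ⇔ Adj claw i j)
    pair {zero} {suc zero} _ = edge tt c~x
    pair {zero} {suc (suc zero)} _ = edge tt c~y
    pair {zero} {suc (suc (suc zero))} _ = edge tt c~z
    pair {suc zero} {suc (suc zero)} _ = non-edge (λ ()) x≢y x≁y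
    pair {suc zero} {suc (suc (suc zero))} _ = non-edge (λ ()) x≢z x≁z
    pair {suc (suc zero)} {suc (suc (suc zero))} _ = non-edge (λ ()) y≢z y≁z
    pair {_} {zero} ()
    pair {suc zero} {suc zero} (s≤s ())
    pair {suc (suc zero)} {suc zero} (s≤s ())
    pair {suc (suc zero)} {suc (suc zero)} (s≤s (s≤s ()))
    pair {suc (suc (suc zero))} {suc zero} (s≤s ())
    pair {suc (suc (suc zero))} {suc (suc zero)} (s≤s (s≤s ()))
    pair {suc (suc (suc zero))} {suc (suc (suc zero))} (s≤s (s≤s (s≤s ())))

  -- Unlike for C₅, the distinctness of opposite vertices does not follow from the
  -- adjacencies: without it the fields would also describe an induced path on three vertices.
  record InducedC4 : Set where
    field
      v₁ v₂ v₃ v₄ : Fin n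
      v₁~v₂ : v₁ ~ v₂
      v₂~v₃ : v₂ ~ v₃
      v₃~v₄ : v₃ ~ v₄
      v₄~v₁ : v₄ ~ v₁
      v₁≁v₃ : v₁ ≁ v₃
      v₂≁v₄ : v₂ ≁ v₄
      v₁≢v₃ : v₁ ≢ v₃
      v₂≢v₄ : v₂ ≢ v₄

  rotateC4 : InducedC4 → InducedC4
  rotateC4 C = record
    { v₁ = v₂ ; v₂ = v₃ ; v₃ = v₄ ; v₄ = v₁
    ; v₁~v₂ = v₂~v₃ ; v₂~v₃ = v₃~v₄ ; v₃~v₄ = v₄~v₁ ; v₄~v₁ = v₁~v₂
    ; v₁≁v₃ = v₂≁v₄ ; v₂≁v₄ = ≁-sym v₁≁v₃
    ; v₁≢v₃ = v₂≢v₄ ; v₂≢v₄ = ≢-sym v₁≢v₃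
    }
    where open InducedC4 C

  record InducedC5 : Set where
    field
      v₁ v₂ v₃ v₄ v₅ : Fin n
      v₁~v₂ : v₁ ~ v₂
      v₂~v₃ : v₂ ~ v₃
      v₃~v₄ : v₃ ~ v₄
      v₄~v₅ : v₄ ~ v₅
      v₅~v₁ : v₅ ~ v₁
      v₁≁v₃ : v₁ ≁ v₃
      v₂≁v₄ : v₂ ≁ v₄
      v₃≁v₅ : v₃ ≁ v₅
      v₄≁v₁ : v₄ ≁ v₁
      v₅≁v₂ : v₅ ≁ v₂

  rotateC5 : InducedC5 → InducedC5
  rotateC5 C = record
    { v₁ = v₂ ; v₂ = v₃ ; v₃ = v₄ ; v₄ = v₅ ; v₅ = v₁
    ; v₁~v₂ = v₂~v₃ ; v₂~v₃ = v₃~v₄ ; v₃~v₄ = v₄~v₅ ; v₄~v₅ = v₅~v₁ ; v₅~v₁ = v₁~v₂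
    ; v₁≁v₃ = v₂≁v₄ ; v₂≁v₄ = v₃≁v₅ ; v₃≁v₅ = v₄≁v₁ ; v₄≁v₁ = v₅≁v₂ ; v₅≁v₂ = v₁≁v₃
    }
    where open InducedC5 C

  NonIsolated : Fin n → Set
  NonIsolated x = ∃ (x ~_)

  walk⇒nonIsolated : ∀ {x y} → Star _~_ x y → x ≢ y → NonIsolated x
  walk⇒nonIsolated ε x≢x = ⊥-elim (x≢x refl)
  walk⇒nonIsolated (x~z ◅ _) _ = _ , x~z

  connected⇒nonIsolated : Connected G → ∀ {u v} → u ≢ v → ∀ x → NonIsolated x
  connected⇒nonIsolated conn {u} {v} u≢v x with x ≟ u
  ... | yes refl = walk⇒nonIsolated (conn x v) u≢v
  ... | no x≢u = walk⇒nonIsolated (conn x u) x≢u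

  Simplicial : Fin n → Set
  Simplicial x = ∀ {p q} → x ~ p → x ~ q → p ≢ q → p ~ q

  NonSimplicial : Fin n → Set
  NonSimplicial x = ∃₂ λ p q → x ~ p × x ~ q × p ≢ q × p ≁ q

  nonSimplicial? : ∀ x → Dec (NonSimplicial x)
  nonSimplicial? x = any? λ p → any? λ q → x ~? p ×-dec x ~? q ×-dec ¬? (p ≟ q) ×-dec ¬? (p ~? q)

  ¬nonSimplicial⇒simplicial : ∀ {x} → ¬ NonSimplicial x → Simplicial x
  ¬nonSimplicial⇒simplicial ¬ns {p} {q} x~p x~q p≢q =
    decidable-stable (p ~? q) λ p≁q → ¬ns (p , q , x~p , x~q , p≢q , p≁q)

  simplicial⇒¬nonSimplicial : ∀ {x} → Simplicial x → ¬ NonSimplicial x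
  simplicial⇒¬nonSimplicial s (_ , _ , x~p , x~q , p≢q , p≁q) = p≁q (s x~p x~q p≢q)

  simplicial? : ∀ x → Dec (Simplicial x)
  simplicial? x = map′ ¬nonSimplicial⇒simplicial simplicial⇒¬nonSimplicial (¬? (nonSimplicial? x))

  simplicial-neighbour-≁ : ∀ {w x y} → Simplicial w → y ~ w → x ≢ y → x ≁ y → x ≁ w
  simplicial-neighbour-≁ simplicial-w y~w x≢y x≁y x~w = x≁y (simplicial-w (~-sym x~w) (~-sym y~w) x≢y)

  module FoldesHammer (2K2-free : Free 2K2 G) (C4-free : ¬ InducedC4) (C5-free : ¬ InducedC5) where

    separated-wedges⇒⊥ : ∀ {x y q r s} → x ≁ y → x ~ q → q ≁ y →
                         y ~ r → y ~ s → r ≢ s → r ≁ s → s ≁ x → ⊥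
    separated-wedges⇒⊥ {x} {y} {q} {r} {s} x≁y x~q q≁y y~r y~s r≢s r≁s s≁x = close (q ~? r) (r ~? x)
      where
      q~s : q ~ s
      q~s = decidable-stable (q ~? s) λ q≁s → 2K2-free (induced-2K2 x~q y~s x≁y (≁-sym s≁x) q≁y q≁s)

      close : Dec (q ~ r) → Dec (r ~ x) → ⊥
      close (yes q~r) _ = C4-free record
        { v₁ = q ; v₂ = r ; v₃ = y ; v₄ = s
        ; v₁~v₂ = q~r ; v₂~v₃ = ~-sym y~r ; v₃~v₄ = y~s ; v₄~v₁ = ~-sym q~s
        ; v₁≁v₃ = q≁y ; v₂≁v₄ = r≁s ; v₁≢v₃ = separated⇒≢ x~q x≁y ; v₂≢v₄ = r≢s
        }
      close (no q≁r) (yes r~x) = C5-free record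
        { v₁ = x ; v₂ = r ; v₃ = y ; v₄ = s ; v₅ = q
        ; v₁~v₂ = ~-sym r~x ; v₂~v₃ = ~-sym y~r ; v₃~v₄ = y~s ; v₄~v₅ = ~-sym q~s ; v₅~v₁ = ~-sym x~q
        ; v₁≁v₃ = x≁y ; v₂≁v₄ = r≁s ; v₃≁v₅ = ≁-sym q≁y ; v₄≁v₁ = s≁x ; v₅≁v₂ = q≁r
        }
      close (no q≁r) (no r≁x) = 2K2-free (induced-2K2 x~q y~r x≁y (≁-sym r≁x) q≁y q≁r)

    escaping-wedge : ∀ {x y} → NonSimplicial x → x ≢ y → x ≁ y →
                     ∃₂ λ p q → x ~ p × x ~ q × p ≢ q × p ≁ q × q ≁ y
    escaping-wedge {x} {y} (p , q , x~p , x~q , p≢q , p≁q) x≢y x≁y with p ~? y | q ~? y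
    ... | _ | no q≁y = p , q , x~p , x~q , p≢q , p≁q , q≁y
    ... | no p≁y | yes _ = q , p , x~q , x~p , ≢-sym p≢q , ≁-sym p≁q , p≁y
    ... | yes p~y | yes q~y = ⊥-elim (C4-free record
      { v₁ = x ; v₂ = p ; v₃ = y ; v₄ = q
      ; v₁~v₂ = x~p ; v₂~v₃ = p~y ; v₃~v₄ = ~-sym q~y ; v₄~v₁ = ~-sym x~q
      ; v₁≁v₃ = x≁y ; v₂≁v₄ = p≁q ; v₁≢v₃ = x≢y ; v₂≢v₄ = p≢q
      })

    nonSimplicial-adjacent : ∀ {x y} → NonSimplicial x → NonSimplicial y → x ≢ y → x ~ y
    nonSimplicial-adjacent x-ns y-ns x≢y = decidable-stable (_ ~? _) λ x≁y →
      let (_ , _ , _ , x~q , _ , _ , q≁y) = escaping-wedge x-ns x≢y x≁y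
          (_ , _ , y~r , y~s , r≢s , r≁s , s≁x) = escaping-wedge y-ns (≢-sym x≢y) (≁-sym x≁y)
      in separated-wedges⇒⊥ x≁y x~q q≁y y~r y~s r≢s r≁s s≁x

    -- A neighbour t of x missing y is adjacent to y′ (else x t, y y′ is a 2K₂), hence to y.
    nonSimplicial-adjacent-simplicial : ∀ {x y y′} → NonSimplicial x → Simplicial y →
                                        y ~ y′ → Simplicial y′ → x ≢ y → x ~ y
    nonSimplicial-adjacent-simplicial {x} {y} {y′}
      (p , q , x~p , x~q , p≢q , p≁q) simplicial-y y~y′ simplicial-y′ x≢y =
      decidable-stable (x ~? y) λ x≁y → p≁q (simplicial-y (reaches-y x≁y x~p) (reaches-y x≁y x~q) p≢q)
      where
      reaches-y : ∀ {t} → x ≁ y → x ~ t → y ~ t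
      reaches-y {t} x≁y x~t = decidable-stable (y ~? t) λ y≁t →
        2K2-free (induced-2K2 x~t y~y′ x≁y (simplicial-neighbour-≁ simplicial-y′ y~y′ x≢y x≁y)
                    (≁-sym y≁t) (simplicial-neighbour-≁ simplicial-y′ y~y′ (separated⇒≢ x~t x≁y) (≁-sym y≁t)))

    simplicial-neighbours-adjacent : ∀ {x x′ y y′} → x ~ x′ → Simplicial x′ →
                                     y ~ y′ → Simplicial y′ → x ≢ y → x ~ y
    simplicial-neighbours-adjacent {x} {x′} {y} {y′} x~x′ simplicial-x′ y~y′ simplicial-y′ x≢y =
      decidable-stable (x ~? y) λ x≁y →
        let x′≁y = ≁-sym (simplicial-neighbour-≁ simplicial-x′ x~x′ (≢-sym x≢y) (≁-sym x≁y))
        in 2K2-free (induced-2K2 x~x′ y~y′ x≁y (simplicial-neighbour-≁ simplicial-y′ y~y′ x≢y x≁y)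
                      x′≁y (simplicial-neighbour-≁ simplicial-y′ y~y′ (separated⇒≢ x~x′ x≁y) x′≁y))

    InClique : Fin n → Set
    InClique v = NonSimplicial v ⊎ (Simplicial v × ∃ λ w → v ~ w × Simplicial w)

    inClique? : ∀ v → Dec (InClique v)
    inClique? v = nonSimplicial? v ⊎-dec (simplicial? v ×-dec any? λ w → v ~? w ×-dec simplicial? w)

    inClique-adjacent : ∀ {u v} → InClique u → InClique v → u ≢ v → u ~ v
    inClique-adjacent (inj₁ u-ns) (inj₁ v-ns) = nonSimplicial-adjacent u-ns v-ns
    inClique-adjacent (inj₁ u-ns) (inj₂ (v-s , _ , v~w , w-s)) = nonSimplicial-adjacent-simplicial u-ns v-s v~w w-s
    inClique-adjacent (inj₂ (u-s , _ , u~w , w-s)) (inj₁ v-ns) u≢v =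
      ~-sym (nonSimplicial-adjacent-simplicial v-ns u-s u~w w-s (≢-sym u≢v))
    inClique-adjacent (inj₂ (_ , _ , u~u′ , u′-s)) (inj₂ (_ , _ , v~v′ , v′-s)) =
      simplicial-neighbours-adjacent u~u′ u′-s v~v′ v′-s

    notInClique-nonadjacent : ∀ {u v} → ¬ InClique u → ¬ InClique v → u ≁ v
    notInClique-nonadjacent ¬Ku ¬Kv u~v = ¬Ku (inj₂ (simplicial ¬Ku , _ , u~v , simplicial ¬Kv))
      where
      simplicial : ∀ {w} → ¬ InClique w → Simplicial w
      simplicial ¬Kw = ¬nonSimplicial⇒simplicial (¬Kw ∘ inj₁)

    split : IsSplit G
    split = (λ v → does (inClique? v)) , clique , independent
      where
      clique : ∀ u v → does (inClique? u) ≡ true → does (inClique? v) ≡ true → u ≢ v → u ~ v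
      clique u v Ku Kv = inClique-adjacent (does≡true⇒ (inClique? u) Ku) (does≡true⇒ (inClique? v) Kv)

      independent : ∀ u v → does (inClique? u) ≡ false → does (inClique? v) ≡ false → u ≁ v
      independent u v ¬Ku ¬Kv =
        notInClique-nonadjacent (does≡false⇒¬ (inClique? u) ¬Ku) (does≡false⇒¬ (inClique? v) ¬Kv)

  record IndependentTriple : Set where
    field
      vertex : Fin 3 → Fin n
      distinct : ∀ {i j} → i ≢ j → vertex i ≢ vertex j
      independent : ∀ i j → vertex i ≁ vertex j

  α≥3⇒independentTriple : α≥3 G → IndependentTriple
  α≥3⇒independentTriple (a , b , c , a≢b , a≢c , b≢c , a≁b , a≁c , b≁c) = record
    { vertex = vertex
    ; distinct = symmetric-on-<⇒≢ {S = λ i j → vertex i ≢ vertex j} ≢-sym (proj₁ ∘ pair)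
    ; independent = independent
    }
    where
    vertex : Fin 3 → Fin n
    vertex zero = a
    vertex (suc zero) = b
    vertex (suc (suc zero)) = c

    pair : ∀ {i j} → i < j → vertex i ≢ vertex j × vertex i ≁ vertex j
    pair {zero} {suc zero} _ = a≢b , a≁b
    pair {zero} {suc (suc zero)} _ = a≢c , a≁c
    pair {suc zero} {suc (suc zero)} _ = b≢c , b≁c
    pair {_} {zero} ()
    pair {suc zero} {suc zero} (s≤s ())
    pair {suc (suc zero)} {suc zero} (s≤s ())
    pair {suc (suc zero)} {suc (suc zero)} (s≤s (s≤s ()))

    independent : ∀ i j → vertex i ≁ vertex j
    independent i j with i ≟ j
    ... | yes refl = irrefl G
    ... | no i≢j = symmetric-on-<⇒≢ {S = λ i j → vertex i ≁ vertex j} ≁-sym (proj₂ ∘ pair) i≢j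

  Dominating : Fin n → Fin n → Set
  Dominating p q = ∀ {x} → NonIsolated x → x ≢ p → x ≢ q → x ≁ p → x ≁ q → ⊥

  module ClawFree (2K2-free : Free 2K2 G) (claw-free : Free claw G) where

    module _ (C : InducedC4) where
      open InducedC4 C

      anticomplete-C4-neighbour-≁v₁ : ∀ {x y} → x ~ y → x ≁ v₁ → x ≁ v₂ → x ≁ v₃ → x ≁ v₄ → y ≁ v₁
      anticomplete-C4-neighbour-≁v₁ {x} {y} x~y x≁v₁ x≁v₂ x≁v₃ x≁v₄ y~v₁ =
        claw-free (induced-claw y~v₂ y~v₄ (~-sym x~y) v₂≁v₄ (≁-sym x≁v₂) (≁-sym x≁v₄)
                     v₂≢v₄ (separated⇒≢ v₁~v₂ (≁-sym x≁v₁)) (separated⇒≢ (~-sym v₄~v₁) (≁-sym x≁v₁)))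
        where
        y≁v₃ : y ≁ v₃
        y≁v₃ y~v₃ = claw-free (induced-claw y~v₁ y~v₃ (~-sym x~y) v₁≁v₃ (≁-sym x≁v₁) (≁-sym x≁v₃)
                                 v₁≢v₃ (separated⇒≢ (~-sym v₁~v₂) (≁-sym x≁v₂)) (separated⇒≢ v₂~v₃ (≁-sym x≁v₂)))
        y~v₄ : y ~ v₄
        y~v₄ = decidable-stable (y ~? v₄) λ y≁v₄ → 2K2-free (induced-2K2 x~y v₃~v₄ x≁v₃ x≁v₄ y≁v₃ y≁v₄)
        y~v₂ : y ~ v₂
        y~v₂ = decidable-stable (y ~? v₂) λ y≁v₂ → 2K2-free (induced-2K2 x~y v₂~v₃ x≁v₂ x≁v₃ y≁v₂ y≁v₃)

    module _ (C : InducedC4) where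
      open InducedC4 C

      C4-dominates : ∀ {x} → NonIsolated x → x ≁ v₁ → x ≁ v₂ → x ≁ v₃ → x ≁ v₄ → ⊥
      C4-dominates (y , x~y) x≁v₁ x≁v₂ x≁v₃ x≁v₄ =
        2K2-free (induced-2K2 x~y v₁~v₂ x≁v₁ x≁v₂
                    (anticomplete-C4-neighbour-≁v₁ C x~y x≁v₁ x≁v₂ x≁v₃ x≁v₄)
                    (anticomplete-C4-neighbour-≁v₁ (rotateC4 C) x~y x≁v₂ x≁v₃ x≁v₄ x≁v₁))

      C4-dominating-pair : Dominating v₁ v₃
      C4-dominating-pair {x} x-nonIsolated x≢v₁ x≢v₃ x≁v₁ x≁v₃ with x ~? v₂ | x ~? v₄
      ... | yes x~v₂ | _ = claw-free (induced-claw (~-sym v₁~v₂) v₂~v₃ (~-sym x~v₂) v₁≁v₃ (≁-sym x≁v₁) (≁-sym x≁v₃)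
                                       v₁≢v₃ (≢-sym x≢v₁) (≢-sym x≢v₃))
      ... | _ | yes x~v₄ = claw-free (induced-claw v₄~v₁ (~-sym v₃~v₄) (~-sym x~v₄) v₁≁v₃ (≁-sym x≁v₁) (≁-sym x≁v₃)
                                       v₁≢v₃ (≢-sym x≢v₁) (≢-sym x≢v₃))
      ... | no x≁v₂ | no x≁v₄ = C4-dominates x-nonIsolated x≁v₁ x≁v₂ x≁v₃ x≁v₄

    module _ (C : InducedC5) where
      open InducedC5 C

      anticomplete-C5-neighbour-≁v₁ : ∀ {x y} → x ~ y → x ≁ v₁ → x ≁ v₂ → x ≁ v₃ → x ≁ v₄ → x ≁ v₅ → y ≁ v₁
      anticomplete-C5-neighbour-≁v₁ {x} {y} x~y x≁v₁ x≁v₂ x≁v₃ x≁v₄ x≁v₅ y~v₁ =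
        2K2-free (induced-2K2 x~y v₃~v₄ x≁v₃ x≁v₄ y≁v₃ y≁v₄)
        where
        v₁≢x : v₁ ≢ x
        v₁≢x = separated⇒≢ (~-sym v₁~v₂) (≁-sym x≁v₂)
        y≁v₃ : y ≁ v₃
        y≁v₃ y~v₃ = claw-free (induced-claw y~v₁ y~v₃ (~-sym x~y) v₁≁v₃ (≁-sym x≁v₁) (≁-sym x≁v₃)
                                 (separated⇒≢ v₅~v₁ (≁-sym v₃≁v₅)) v₁≢x (separated⇒≢ v₂~v₃ (≁-sym x≁v₂)))
        y≁v₄ : y ≁ v₄
        y≁v₄ y~v₄ = claw-free (induced-claw y~v₁ y~v₄ (~-sym x~y) (≁-sym v₄≁v₁) (≁-sym x≁v₁) (≁-sym x≁v₄)
                                 (separated⇒≢ (~-sym v₁~v₂) v₂≁v₄) v₁≢x (separated⇒≢ v₃~v₄ (≁-sym x≁v₃)))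

    module _ (C : InducedC5) where
      open InducedC5 C

      C5-dominates : ∀ {x} → NonIsolated x → x ≁ v₁ → x ≁ v₂ → x ≁ v₃ → x ≁ v₄ → x ≁ v₅ → ⊥
      C5-dominates (y , x~y) x≁v₁ x≁v₂ x≁v₃ x≁v₄ x≁v₅ =
        2K2-free (induced-2K2 x~y v₁~v₂ x≁v₁ x≁v₂
                    (anticomplete-C5-neighbour-≁v₁ C x~y x≁v₁ x≁v₂ x≁v₃ x≁v₄ x≁v₅)
                    (anticomplete-C5-neighbour-≁v₁ (rotateC5 C) x~y x≁v₂ x≁v₃ x≁v₄ x≁v₅ x≁v₁))

      C5-dominating-pair : Dominating v₁ v₃
      C5-dominating-pair {x} x-nonIsolated x≢v₁ x≢v₃ x≁v₁ x≁v₃ with x ~? v₂ | x ~? v₄ | x ~? v₅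
      ... | yes x~v₂ | _ | _ = claw-free (induced-claw (~-sym v₁~v₂) v₂~v₃ (~-sym x~v₂) v₁≁v₃ (≁-sym x≁v₁) (≁-sym x≁v₃)
                                           (separated⇒≢ v₅~v₁ (≁-sym v₃≁v₅)) (≢-sym x≢v₁) (≢-sym x≢v₃))
      ... | no x≁v₂ | yes x~v₄ | _ = 2K2-free (induced-2K2 x~v₄ v₁~v₂ x≁v₁ x≁v₂ v₄≁v₁ (≁-sym v₂≁v₄))
      ... | no x≁v₂ | _ | yes x~v₅ = 2K2-free (induced-2K2 x~v₅ v₂~v₃ x≁v₂ x≁v₃ v₅≁v₂ (≁-sym v₃≁v₅))
      ... | no x≁v₂ | no x≁v₄ | no x≁v₅ = C5-dominates x-nonIsolated x≁v₁ x≁v₂ x≁v₃ x≁v₄ x≁v₅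

    module _ (T : IndependentTriple) (nonIsolated : ∀ x → NonIsolated x) where
      open IndependentTriple T

      no-vertex-sees-triple : ∀ {c} → (∀ i → c ~ vertex i) → ⊥
      no-vertex-sees-triple c~T =
        claw-free (induced-claw (c~T zero) (c~T (suc zero)) (c~T (suc (suc zero)))
                     (independent _ _) (independent _ _) (independent _ _)
                     (distinct λ ()) (distinct λ ()) (distinct λ ()))

      -- p misses some vertex of the triple, which q must then see, and vice versa.
      nonadjacent-pair-misses-triple : ∀ {p q} → p ≁ q → (∀ i → vertex i ≁ p → vertex i ≁ q → ⊥) → ⊥
      nonadjacent-pair-misses-triple {p} {q} p≁q sees with all? (λ i → p ~? vertex i) | all? (λ i → q ~? vertex i)
      ... | yes p~T | _ = no-vertex-sees-triple p~T
      ... | _ | yes q~T = no-vertex-sees-triple q~T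
      ... | no ¬p~T | no ¬q~T =
        let (i , p≁tᵢ) = ¬∀⟶∃¬ 3 _ (λ i → p ~? vertex i) ¬p~T
            (j , q≁tⱼ) = ¬∀⟶∃¬ 3 _ (λ i → q ~? vertex i) ¬q~T
            tᵢ~q = decidable-stable (vertex i ~? q) (sees i (≁-sym p≁tᵢ))
            tⱼ~p = decidable-stable (vertex j ~? p) λ tⱼ≁p → sees j tⱼ≁p (≁-sym q≁tⱼ)
        in 2K2-free (induced-2K2 tᵢ~q tⱼ~p (independent i j) (≁-sym p≁tᵢ) q≁tⱼ (≁-sym p≁q))

      dominating-pair-meets-triple : ∀ {p q} → p ≁ q → Dominating p q →
                                     (∀ i → vertex i ≢ p) → (∀ i → vertex i ≢ q) → ⊥
      dominating-pair-meets-triple p≁q dominating ≢p ≢q =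
        nonadjacent-pair-misses-triple p≁q λ i → dominating (nonIsolated (vertex i)) (≢p i) (≢q i)

      member-excludes-neighbours : ∀ {i u v} → vertex i ≡ u → u ~ v → ∀ j → vertex j ≢ v
      member-excludes-neighbours {i} refl u~v j refl = independent i j u~v

      no-induced-C4 : ¬ InducedC4
      no-induced-C4 C =
        let open InducedC4 C in
        case any? (λ i → (vertex i ≟ v₂) ⊎-dec (vertex i ≟ v₄)) of λ where
        (no ∌v₂v₄) → dominating-pair-meets-triple v₂≁v₄ (C4-dominating-pair (rotateC4 C))
                       (λ i tᵢ≡v₂ → ∌v₂v₄ (i , inj₁ tᵢ≡v₂)) (λ i tᵢ≡v₄ → ∌v₂v₄ (i , inj₂ tᵢ≡v₄))
        (yes (_ , inj₁ tᵢ≡v₂)) → dominating-pair-meets-triple v₁≁v₃ (C4-dominating-pair C)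
                                   (member-excludes-neighbours tᵢ≡v₂ (~-sym v₁~v₂))
                                   (member-excludes-neighbours tᵢ≡v₂ v₂~v₃)
        (yes (_ , inj₂ tᵢ≡v₄)) → dominating-pair-meets-triple v₁≁v₃ (C4-dominating-pair C)
                                   (member-excludes-neighbours tᵢ≡v₄ v₄~v₁)
                                   (member-excludes-neighbours tᵢ≡v₄ (~-sym v₃~v₄))

      no-induced-C5 : ¬ InducedC5
      no-induced-C5 C =
        let open InducedC5 C in
        case any? (λ i → (vertex i ≟ v₂) ⊎-dec (vertex i ≟ v₄)) of λ where
        (no ∌v₂v₄) → dominating-pair-meets-triple v₂≁v₄ (C5-dominating-pair (rotateC5 C))
                       (λ i tᵢ≡v₂ → ∌v₂v₄ (i , inj₁ tᵢ≡v₂)) (λ i tᵢ≡v₄ → ∌v₂v₄ (i , inj₂ tᵢ≡v₄))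
        (yes (_ , inj₁ tᵢ≡v₂)) → dominating-pair-meets-triple v₁≁v₃ (C5-dominating-pair C)
                                   (member-excludes-neighbours tᵢ≡v₂ (~-sym v₁~v₂))
                                   (member-excludes-neighbours tᵢ≡v₂ v₂~v₃)
        (yes (_ , inj₂ tᵢ≡v₄)) → dominating-pair-meets-triple v₃≁v₅ (C5-dominating-pair (rotateC5 (rotateC5 C)))
                                   (member-excludes-neighbours tᵢ≡v₄ (~-sym v₃~v₄))
                                   (member-excludes-neighbours tᵢ≡v₄ v₄~v₅)

theorem3p3 : ∀ {n : ℕ} (G : Graph n) → Connected G → Free 2K2 G → Free claw G → α≥3 G → IsSplit G
theorem3p3 G connected 2K2-free claw-free α3 =
  FoldesHammer.split G 2K2-free (no-induced-C4 T nonIsolated) (no-induced-C5 T nonIsolated)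
  where
  open ClawFree G 2K2-free claw-free

  T : IndependentTriple G
  T = α≥3⇒independentTriple G α3

  nonIsolated : ∀ x → NonIsolated G x
  nonIsolated = connected⇒nonIsolated G connected (IndependentTriple.distinct T {zero} {suc zero} λ ())
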